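{- Let $(m_n)_{n\ge0}$ be the Mephisto Waltz sequence, where $m_n$ is the number of digits $2$ in the base-$3$ representation of $n$, taken modulo $2$, and let $\mathrm{sum}_{\mathrm{mw}}(n)=\sum_{i=0}^{n}m_i$. Then for every integer $r\ge 0$, with $n=(3^{2r}-1)/2$, we have $\mathrm{sum}_{\mathrm{mw}}(n)=n/2-r$. -}

module Defs where

open import Data.Nat using (ℕ; zero; suc; _+_; _*_; _/_; _%_; _≟_)
open import Relation.Nullary using (yes; no)

-- Defined with fuel: count2 fuel n is correct whenever fuel ≥ n (each
-- step divides n by 3, so n steps always suffice); count2s uses fuel = n.
count2-fuel : ℕ → ℕ → ℕ
count2-fuel zero    n = 0
count2-fuel (suc k) zero = 0
count2-fuel (suc k) n@(suc _) with n % 3 ≟ 2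
... | yes _ = suc (count2-fuel k (n / 3))
... | no  _ = count2-fuel k (n / 3)

count2s : ℕ → ℕ
count2s n = count2-fuel n n

mw : ℕ → ℕ
mw n = count2s n % 2

summw : ℕ → ℕ
summw zero    = mw 0
summw (suc n) = summw n + mw (suc n)

{-# OPTIONS --safe #-}
-- Reading n = 3q + d digit by digit, m(3q) = m(3q+1) = m(q) and m(3q+2) = 1 - m(q), so
-- every block of three consecutive terms sums to m(q) + 1, i.e. Σ_{i<3N} m(i) = Σ_{i<N} m(i) + N.
-- The number (3^L - 1)/2 is the base-3 repunit 11…1, on which m vanishes; iterating the
-- block identity along repunits (u ↦ 3u + 1) gives 2 · sum_mw((3^L - 1)/2) + L = (3^L - 1)/2.
module Submission where

open import Defs
open import Data.Nat using (ℕ; zero; suc; _+_; _*_; _^_; _∸_; _/_; _%_; _≤_; _<_; s≤s; z≤n; _≟_)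
open import Data.Integer using (+_; _-_; _⊖_)
open import Data.Nat.Properties
open import Data.Nat.DivMod
open import Data.Nat.Divisibility using (divides-refl)
open import Data.Nat.Tactic.RingSolver using (solve-∀)
import Data.Integer.Properties as ℤ
open import Relation.Binary.PropositionalEquality using (_≡_; refl; sym; trans; cong; cong₂; module ≡-Reasoning)
open import Relation.Nullary using (yes; no)

-- Tests the digit with the same `_≟_` as count2-fuel, so that one unfolding of
-- count2-fuel is definitionally a digit count plus a recursive call.
count2-digit : ℕ → ℕ
count2-digit d with d ≟ 2
... | yes _ = 1
... | no  _ = 0

count2-fuel-zero : ∀ k → count2-fuel k 0 ≡ 0
count2-fuel-zero zero    = refl
count2-fuel-zero (suc k) = refl

count2-fuel-suc : ∀ k n → count2-fuel (suc k) n ≡ count2-digit (n % 3) + count2-fuel k (n / 3)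
count2-fuel-suc k zero = sym (count2-fuel-zero k)
count2-fuel-suc k (suc m) with suc m % 3 ≟ 2
... | yes _ = refl
... | no  _ = refl

[1+m]/3≤m : ∀ m → suc m / 3 ≤ m
[1+m]/3≤m m = <⇒≤pred (m/n<m (suc m) 3 (s≤s (s≤s z≤n)))

count2-fuel-irrelevant : ∀ {k j} n → n ≤ k → n ≤ j → count2-fuel k n ≡ count2-fuel j n
count2-fuel-irrelevant {k} {j} zero _ _ = trans (count2-fuel-zero k) (sym (count2-fuel-zero j))
count2-fuel-irrelevant {suc k} {suc j} n@(suc m) (s≤s m≤k) (s≤s m≤j) = begin
  count2-fuel (suc k) n                        ≡⟨ count2-fuel-suc k n ⟩
  count2-digit (n % 3) + count2-fuel k (n / 3) ≡⟨ cong (_+_ (count2-digit (n % 3))) fuel-k≡fuel-j ⟩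
  count2-digit (n % 3) + count2-fuel j (n / 3) ≡⟨ count2-fuel-suc j n ⟨
  count2-fuel (suc j) n                        ∎
  where
  open ≡-Reasoning
  fuel-k≡fuel-j : count2-fuel k (n / 3) ≡ count2-fuel j (n / 3)
  fuel-k≡fuel-j = count2-fuel-irrelevant (n / 3)
    (≤-trans ([1+m]/3≤m m) m≤k) (≤-trans ([1+m]/3≤m m) m≤j)

count2s-step : ∀ n → count2s n ≡ count2-digit (n % 3) + count2s (n / 3)
count2s-step n = begin
  count2-fuel n n                              ≡⟨ count2-fuel-irrelevant n ≤-refl (n≤1+n n) ⟩
  count2-fuel (suc n) n                        ≡⟨ count2-fuel-suc n n ⟩
  count2-digit (n % 3) + count2-fuel n (n / 3) ≡⟨ cong (_+_ (count2-digit (n % 3))) fuel-n≡fuel-n/3 ⟩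
  count2-digit (n % 3) + count2s (n / 3)       ∎
  where
  open ≡-Reasoning
  fuel-n≡fuel-n/3 : count2-fuel n (n / 3) ≡ count2-fuel (n / 3) (n / 3)
  fuel-n≡fuel-n/3 = count2-fuel-irrelevant (n / 3) (m/n≤m n 3) ≤-refl

[d+q*3]%3≡d : ∀ {d} q → d < 3 → (d + q * 3) % 3 ≡ d
[d+q*3]%3≡d {d} q d<3 = trans ([m+kn]%n≡m%n d q 3) (m<n⇒m%n≡m d<3)

[d+q*3]/3≡q : ∀ {d} q → d < 3 → (d + q * 3) / 3 ≡ q
[d+q*3]/3≡q {d} q d<3 = begin
  (d + q * 3) / 3     ≡⟨ +-distrib-/-∣ʳ d (divides-refl q) ⟩
  d / 3 + q * 3 / 3   ≡⟨ cong₂ _+_ (m<n⇒m/n≡0 d<3) (m*n/n≡m q 3) ⟩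
  q                   ∎
  where open ≡-Reasoning

count2s-digit : ∀ {d} q → d < 3 → count2s (d + q * 3) ≡ count2-digit d + count2s q
count2s-digit {d} q d<3 = trans (count2s-step (d + q * 3))
  (cong₂ (λ r n → count2-digit r + count2s n) ([d+q*3]%3≡d q d<3) ([d+q*3]/3≡q q d<3))

mw-*3 : ∀ q → mw (q * 3) ≡ mw q
mw-*3 q = cong (_% 2) (count2s-digit q (s≤s z≤n))

mw-1+*3 : ∀ q → mw (1 + q * 3) ≡ mw q
mw-1+*3 q = cong (_% 2) (count2s-digit q (s≤s (s≤s z≤n)))

mw-2+*3 : ∀ q → mw (2 + q * 3) ≡ suc (count2s q) % 2
mw-2+*3 q = cong (_% 2) (count2s-digit q ≤-refl)

m%2+[1+m]%2≡1 : ∀ m → m % 2 + suc m % 2 ≡ 1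
m%2+[1+m]%2≡1 zero          = refl
m%2+[1+m]%2≡1 (suc zero)    = refl
m%2+[1+m]%2≡1 (suc (suc m)) = m%2+[1+m]%2≡1 m

mw-block : ∀ q → mw (q * 3) + mw (1 + q * 3) + mw (2 + q * 3) ≡ mw q + 1
mw-block q = begin
  mw (q * 3) + mw (1 + q * 3) + mw (2 + q * 3)   ≡⟨ cong₂ _+_ (cong₂ _+_ (mw-*3 q) (mw-1+*3 q)) (mw-2+*3 q) ⟩
  mw q + mw q + suc (count2s q) % 2              ≡⟨ +-assoc (mw q) (mw q) _ ⟩
  mw q + (count2s q % 2 + suc (count2s q) % 2)   ≡⟨ cong (_+_ (mw q)) (m%2+[1+m]%2≡1 (count2s q)) ⟩
  mw q + 1                                       ∎
  where open ≡-Reasoning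

summw< : ℕ → ℕ
summw< zero    = 0
summw< (suc n) = summw< n + mw n

summw≡summw<[1+n] : ∀ n → summw n ≡ summw< (suc n)
summw≡summw<[1+n] zero    = refl
summw≡summw<[1+n] (suc n) = cong (_+ mw (suc n)) (summw≡summw<[1+n] n)

summw<-*3 : ∀ N → summw< (N * 3) ≡ summw< N + N
summw<-*3 zero    = refl
summw<-*3 (suc N) = begin
  summw< (N * 3) + a + b + c     ≡⟨ regroup (summw< (N * 3)) a b c ⟩
  summw< (N * 3) + (a + b + c)   ≡⟨ cong₂ _+_ (summw<-*3 N) (mw-block N) ⟩
  summw< N + N + (mw N + 1)      ≡⟨ rearrange (summw< N) N (mw N) ⟩
  summw< N + mw N + suc N        ∎
  where
  open ≡-Reasoning
  a = mw (N * 3)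
  b = mw (1 + N * 3)
  c = mw (2 + N * 3)
  regroup : ∀ s a b c → s + a + b + c ≡ s + (a + b + c)
  regroup = solve-∀
  rearrange : ∀ s n m → s + n + (m + 1) ≡ s + m + suc n
  rearrange = solve-∀

repunit : ℕ → ℕ
repunit zero    = 0
repunit (suc L) = 1 + repunit L * 3

mw-repunit : ∀ L → mw (repunit L) ≡ 0
mw-repunit zero    = refl
mw-repunit (suc L) = trans (mw-1+*3 (repunit L)) (mw-repunit L)

2*repunit+1≡3^ : ∀ L → 2 * repunit L + 1 ≡ 3 ^ L
2*repunit+1≡3^ zero    = refl
2*repunit+1≡3^ (suc L) = begin
  2 * (1 + repunit L * 3) + 1   ≡⟨ expand (repunit L) ⟩
  3 * (2 * repunit L + 1)       ≡⟨ cong (3 *_) (2*repunit+1≡3^ L) ⟩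
  3 * 3 ^ L                     ∎
  where
  open ≡-Reasoning
  expand : ∀ u → 2 * (1 + u * 3) + 1 ≡ 3 * (2 * u + 1)
  expand = solve-∀

[3^L∸1]/2≡repunit : ∀ L → (3 ^ L ∸ 1) / 2 ≡ repunit L
[3^L∸1]/2≡repunit L = begin
  (3 ^ L ∸ 1) / 2                ≡⟨ cong (λ m → (m ∸ 1) / 2) (2*repunit+1≡3^ L) ⟨
  (2 * repunit L + 1 ∸ 1) / 2    ≡⟨ cong (_/ 2) (m+n∸n≡m (2 * repunit L) 1) ⟩
  2 * repunit L / 2              ≡⟨ cong (_/ 2) (*-comm 2 (repunit L)) ⟩
  repunit L * 2 / 2              ≡⟨ m*n/n≡m (repunit L) 2 ⟩
  repunit L                      ∎
  where open ≡-Reasoning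

summw<-repunit : ∀ L → 2 * summw< (repunit L) + L ≡ repunit L
summw<-repunit zero    = refl
summw<-repunit (suc L) = begin
  2 * (summw< (u * 3) + mw (u * 3)) + suc L   ≡⟨ cong (λ s → 2 * s + suc L) (cong₂ _+_ (summw<-*3 u) mw[u*3]≡0) ⟩
  2 * (summw< u + u + 0) + suc L              ≡⟨ expand (summw< u) u L ⟩
  suc (2 * summw< u + L + 2 * u)              ≡⟨ cong (λ m → suc (m + 2 * u)) (summw<-repunit L) ⟩
  suc (u + 2 * u)                             ≡⟨ collect u ⟩
  1 + u * 3                                   ∎
  where
  open ≡-Reasoning
  u = repunit L
  mw[u*3]≡0 : mw (u * 3) ≡ 0
  mw[u*3]≡0 = trans (mw-*3 u) (mw-repunit L)
  expand : ∀ s u L → 2 * (s + u + 0) + suc L ≡ suc (2 * s + L + 2 * u)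
  expand = solve-∀
  collect : ∀ u → suc (u + 2 * u) ≡ 1 + u * 3
  collect = solve-∀

summw-repunit : ∀ L → 2 * summw (repunit L) + L ≡ repunit L
summw-repunit L = begin
  2 * summw (repunit L) + L    ≡⟨ cong (λ s → 2 * s + L) summw≡summw< ⟩
  2 * summw< (repunit L) + L   ≡⟨ summw<-repunit L ⟩
  repunit L                    ∎
  where
  open ≡-Reasoning
  summw≡summw< : summw (repunit L) ≡ summw< (repunit L)
  summw≡summw< = begin
    summw (repunit L)                       ≡⟨ summw≡summw<[1+n] (repunit L) ⟩
    summw< (repunit L) + mw (repunit L)     ≡⟨ cong (_+_ (summw< (repunit L))) (mw-repunit L) ⟩
    summw< (repunit L) + 0                  ≡⟨ +-identityʳ (summw< (repunit L)) ⟩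
    summw< (repunit L)                      ∎

[2m+2n]/2≡m+n : ∀ m n → (2 * m + 2 * n) / 2 ≡ m + n
[2m+2n]/2≡m+n m n = begin
  (2 * m + 2 * n) / 2   ≡⟨ cong (_/ 2) (2m+2n≡[m+n]*2 m n) ⟩
  (m + n) * 2 / 2       ≡⟨ m*n/n≡m (m + n) 2 ⟩
  m + n                 ∎
  where
  open ≡-Reasoning
  2m+2n≡[m+n]*2 : ∀ m n → 2 * m + 2 * n ≡ (m + n) * 2
  2m+2n≡[m+n]*2 = solve-∀

+[m+n]-+n≡+m : ∀ m n → + (m + n) - + n ≡ + m
+[m+n]-+n≡+m m n = begin
  + (m + n) - + n   ≡⟨ ℤ.[+m]-[+n]≡m⊖n (m + n) n ⟩
  (m + n) ⊖ n       ≡⟨ ℤ.⊖-≥ (m≤n+m n m) ⟩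
  + (m + n ∸ n)     ≡⟨ cong +_ (m+n∸n≡m m n) ⟩
  + m               ∎
  where open ≡-Reasoning

mainTheorem14 : (r : ℕ) → let n = (3 ^ (2 * r) ∸ 1) / 2 in
    + summw n ≡ + (n / 2) - + r
mainTheorem14 r = begin
  + summw n                           ≡⟨ cong (λ m → + summw m) n≡u ⟩
  + s                                 ≡⟨ +[m+n]-+n≡+m s r ⟨
  + (s + r) - + r                     ≡⟨ cong (λ m → + m - + r) u/2≡s+r ⟨
  + (u / 2) - + r                     ≡⟨ cong (λ m → + (m / 2) - + r) n≡u ⟨
  + (n / 2) - + r                     ∎
  where
  open ≡-Reasoning
  n = (3 ^ (2 * r) ∸ 1) / 2
  u = repunit (2 * r)
  s = summw u
  n≡u : n ≡ u
  n≡u = [3^L∸1]/2≡repunit (2 * r)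
  u/2≡s+r : u / 2 ≡ s + r
  u/2≡s+r = trans (cong (_/ 2) (sym (summw-repunit (2 * r)))) ([2m+2n]/2≡m+n s r)
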